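{- Let $\pi$ be a projective plane of order $q$ and let $\phi$ be an embedding of $K_{q,q}$ into $\pi$. Then for every subplane $\pi_0$ of $\pi$ of order $n$, the set $\phi(V(K_{q,q}))$ contains at most $2n$ points of $\pi_0$.
   Context: Graphs are finite, simple and undirected. An embedding of a graph $G=(V,E)$ into a projective plane $\pi=(\mathcal P,\mathcal L,\mathcal I)$ is an injective map $\phi:V\to\mathcal P$ such that the induced map $E\to\mathcal L$, sending an edge $ab$ to the unique line through $\phi(a)$ and $\phi(b)$, is injective. A subplane of $\pi$ is a projective plane $(\mathcal P_0,\mathcal L_0,\mathcal I_0)$ with $\mathcal P_0\subseteq\mathcal P$, $\mathcal L_0\subseteq\mathcal L$, $\mathcal I_0\subseteq\mathcal I$. -}

module Defs where

open import Data.Nat using (ℕ; suc)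
open import Data.Fin using (Fin)
open import Data.Bool using (Bool; true)
open import Data.Sum using (_⊎_; inj₁; inj₂)
open import Data.Product using (Σ; _×_; _,_; proj₁; proj₂; ∃)
open import Relation.Nullary using (¬_)
open import Relation.Binary.PropositionalEquality using (_≡_; _≢_)
open import Function.Bundles using (_↔_)
open import Function.Definitions using (Injective)

-- A projective plane (P, L, I): incidence is Bool-valued, so "p I l" is a proposition.
record ProjectivePlane : Set₁ where
  field
    Point : Set
    Line  : Set
    inc   : Point → Line → Bool

  _I_ : Point → Line → Set
  p I l = inc p l ≡ true

  field
    join : ∀ p q → p ≢ q →
           Σ Line λ l → p I l × q I l × (∀ l' → p I l' → q I l' → l' ≡ l)
    meet : ∀ l m → l ≢ m →
           Σ Point λ p → p I l × p I m × (∀ p' → p' I l → p' I m → p' ≡ p)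
    quad      : Fin 4 → Point
    quad-inj  : Injective _≡_ _≡_ quad
    quad-gen  : ∀ l i j k → i ≢ j → j ≢ k → i ≢ k →
                ¬ (quad i I l × quad j I l × quad k I l)

  lineThrough : ∀ p q → p ≢ q → Line
  lineThrough p q p≢q = proj₁ (join p q p≢q)

open ProjectivePlane public

HasOrder : ProjectivePlane → ℕ → Set
HasOrder π q = ∀ l → Fin (suc q) ↔ Σ (Point π) (λ p → _I_ π p l)

record Subplane (π₀ π : ProjectivePlane) : Set where
  field
    ιP     : Point π₀ → Point π
    ιL     : Line π₀ → Line π
    ιP-inj : Injective _≡_ _≡_ ιP
    ιL-inj : Injective _≡_ _≡_ ιL
    ιI     : ∀ p l → _I_ π₀ p l → _I_ π (ιP p) (ιL l)

open Subplane public

-- Complete bipartite graph K_{q,q}: vertices Fin q ⊎ Fin q, edges = pairs (a , b)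
-- with a on the left and b on the right.
Vertex : ℕ → Set
Vertex q = Fin q ⊎ Fin q

Edge : ℕ → Set
Edge q = Fin q × Fin q

endpoints-distinct : ∀ {q} (π : ProjectivePlane) (φ : Vertex q → Point π) →
  Injective _≡_ _≡_ φ → ∀ (e : Edge q) →
  φ (inj₁ (proj₁ e)) ≢ φ (inj₂ (proj₂ e))
endpoints-distinct π φ φ-inj (a , b) eq with φ-inj eq
... | ()

edgeLine : ∀ {q} (π : ProjectivePlane) (φ : Vertex q → Point π) →
  Injective _≡_ _≡_ φ → Edge q → Line π
edgeLine π φ φ-inj e = lineThrough π _ _ (endpoints-distinct π φ φ-inj e)

record Embedding (q : ℕ) (π : ProjectivePlane) : Set where
  field
    φ            : Vertex q → Point π
    φ-inj        : Injective _≡_ _≡_ φ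
    edgeLine-inj : Injective _≡_ _≡_ (edgeLine π φ φ-inj)

open Embedding public

-- Write A and B for the images of the two sides of K_{q,q}. Fix a = A i and a line ℓ through
-- two points of B; a ∉ ℓ, as ℓ would otherwise carry two edges. The q edge lines at a are
-- distinct lines through a, and a plane of order q has only q + 1 lines through a (they are
-- separated by their meets with ℓ). Hence the line through A i and A j contains every A k,
-- for otherwise it and the line a A k would be two further lines through a; likewise B is
-- collinear, and the edge lines force these two lines to share no point of the embedding.
-- In the subplane π₀ the points of one side thus either number at most one or fill a line
-- of π₀ that the other side avoids. Two such lines meet in a point that is used by neither
-- side, leaving at most n + n points; every other case gives at most (n + 1) + 1 ≤ 2n
-- points, since n ≥ 2.
module Submission where

open import Defs
open import Data.Bool using (true) renaming (_≟_ to _≟ᵇ_)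
open import Data.Empty using (⊥; ⊥-elim)
open import Data.Fin using (Fin; zero; suc; punchOut)
open import Data.Fin.Properties using (injective⇒≤; punchOut-injective; +↔⊎; any?; _≟_)
open import Data.List using (List; _∷_; length; lookup)
open import Data.List.Membership.Propositional.Properties using (∈-lookup)
open import Data.List.Relation.Unary.All as All using (All)
open import Data.List.Relation.Unary.AllPairs using (_∷_)
open import Data.List.Relation.Unary.Unique.Propositional using (Unique)
open import Data.Nat using (ℕ; suc; _+_; _*_; _≤_)
import Data.Nat.Properties as ℕ
open import Data.Product using (∃; _,_; proj₁; proj₂)
open import Data.Sum using (_⊎_; inj₁; inj₂; swap)
open import Data.Sum.Properties using (inj₁-injective; inj₂-injective; swap-involutive)
open import Data.Vec using ([]; _∷_) renaming (lookup to lookupᵥ)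
open import Function.Base using (_∘_)
open import Function.Bundles using (Inverse; Injection)
open import Function.Definitions using (Injective)
open import Function.Properties.Inverse using (↔⇒↣; ↔-sym)
open import Relation.Nullary using (¬_; Dec; yes; no; contradiction)
open import Relation.Nullary.Decidable using (¬?; _×-dec_; decidable-stable)
open import Relation.Binary.PropositionalEquality
  using (_≡_; _≢_; refl; sym; trans; cong; subst)

record Fits {m : ℕ} (P : Fin m → Set) (a : ℕ) : Set where
  field
    code           : ∀ {t} → P t → Fin a
    code-injective : ∀ {t t'} (p : P t) (p' : P t') → code p ≡ code p' → t ≡ t'

open Fits

atMostOne-fits : ∀ {m} {P : Fin m → Set} → (∀ {t t'} → P t → P t' → t ≡ t') → Fits P 1
atMostOne-fits unique = record { code = λ _ → zero ; code-injective = λ p p' _ → unique p p' }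

partition-bound : ∀ {m a b} {P Q : Fin m → Set} →
                  (∀ t → P t ⊎ Q t) → Fits P a → Fits Q b → m ≤ a + b
partition-bound {a = a} {b} {P} {Q} cover FP FQ =
  injective⇒≤ (code⊎-injective (cover _) (cover _) ∘ Injection.injective (↔⇒↣ (↔-sym +↔⊎)))
  where
  code⊎ : ∀ {t} → P t ⊎ Q t → Fin a ⊎ Fin b
  code⊎ (inj₁ p) = inj₁ (code FP p)
  code⊎ (inj₂ q) = inj₂ (code FQ q)

  code⊎-injective : ∀ {t t'} (c : P t ⊎ Q t) (c' : P t' ⊎ Q t') → code⊎ c ≡ code⊎ c' → t ≡ t'
  code⊎-injective (inj₁ p) (inj₁ p') e = code-injective FP p p' (inj₁-injective e)
  code⊎-injective (inj₂ q) (inj₂ q') e = code-injective FQ q q' (inj₂-injective e)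
  code⊎-injective (inj₁ _) (inj₂ _) ()
  code⊎-injective (inj₂ _) (inj₁ _) ()

lookup₃-injective : ∀ {A : Set} {x y z : A} → x ≢ y → x ≢ z → y ≢ z →
                    Injective _≡_ _≡_ (lookupᵥ (x ∷ y ∷ z ∷ []))
lookup₃-injective _   _   _   {zero}           {zero}           _ = refl
lookup₃-injective x≢y _   _   {zero}           {suc zero}       e = contradiction e x≢y
lookup₃-injective _   x≢z _   {zero}           {suc (suc zero)} e = contradiction e x≢z
lookup₃-injective x≢y _   _   {suc zero}       {zero}           e = contradiction (sym e) x≢y
lookup₃-injective _   _   _   {suc zero}       {suc zero}       _ = refl
lookup₃-injective _   _   y≢z {suc zero}       {suc (suc zero)} e = contradiction e y≢z
lookup₃-injective _   x≢z _   {suc (suc zero)} {zero}           e = contradiction (sym e) x≢z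
lookup₃-injective _   _   y≢z {suc (suc zero)} {suc zero}       e = contradiction (sym e) y≢z
lookup₃-injective _   _   _   {suc (suc zero)} {suc (suc zero)} _ = refl

lookup-injective : ∀ {A : Set} {xs : List A} → Unique xs → Injective _≡_ _≡_ (lookup xs)
lookup-injective {xs = _ ∷ _}  _         {zero}  {zero}   _ = refl
lookup-injective {xs = _ ∷ _}  (x∉ ∷ _)  {zero}  {suc t'} e = contradiction e (All.lookup x∉ (∈-lookup t'))
lookup-injective {xs = _ ∷ _}  (x∉ ∷ _)  {suc t} {zero}   e = contradiction (sym e) (All.lookup x∉ (∈-lookup t))
lookup-injective {xs = _ ∷ _}  (_ ∷ uxs) {suc t} {suc t'} e = cong suc (lookup-injective uxs e)

module Plane (π : ProjectivePlane) where
  open ProjectivePlane π public using () renaming (_I_ to _on_)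

  on? : ∀ p l → Dec (p on l)
  on? p l = inc π p l ≟ᵇ true

  lineThrough-onˡ : ∀ {p r} (p≢r : p ≢ r) → p on lineThrough π p r p≢r
  lineThrough-onˡ {p} {r} p≢r = proj₁ (proj₂ (join π p r p≢r))

  lineThrough-onʳ : ∀ {p r} (p≢r : p ≢ r) → r on lineThrough π p r p≢r
  lineThrough-onʳ {p} {r} p≢r = proj₁ (proj₂ (proj₂ (join π p r p≢r)))

  lineThrough-unique : ∀ {p r} (p≢r : p ≢ r) {l} → p on l → r on l → l ≡ lineThrough π p r p≢r
  lineThrough-unique {p} {r} p≢r {l} = proj₂ (proj₂ (proj₂ (join π p r p≢r))) l

  line-unique : ∀ {p r} → p ≢ r → ∀ {l l'} → p on l → r on l → p on l' → r on l' → l ≡ l'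
  line-unique p≢r p∈l r∈l p∈l' r∈l' =
    trans (lineThrough-unique p≢r p∈l r∈l) (sym (lineThrough-unique p≢r p∈l' r∈l'))

  meetPoint : ∀ {l l'} → l ≢ l' → Point π
  meetPoint {l} {l'} l≢l' = proj₁ (meet π l l' l≢l')

  meetPoint-onˡ : ∀ {l l'} (l≢l' : l ≢ l') → meetPoint l≢l' on l
  meetPoint-onˡ {l} {l'} l≢l' = proj₁ (proj₂ (meet π l l' l≢l'))

  meetPoint-onʳ : ∀ {l l'} (l≢l' : l ≢ l') → meetPoint l≢l' on l'
  meetPoint-onʳ {l} {l'} l≢l' = proj₁ (proj₂ (proj₂ (meet π l l' l≢l')))

  module Order {n : ℕ} (order : HasOrder π n) where

    index : ∀ {p l} → p on l → Fin (suc n)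
    index {p} {l} p∈l = Inverse.from (order l) (p , p∈l)

    index-injective : ∀ {p r l} (p∈l : p on l) (r∈l : r on l) → index p∈l ≡ index r∈l → p ≡ r
    index-injective {l = l} _ _ = cong proj₁ ∘ Injection.injective (↔⇒↣ (↔-sym (order l)))

    onLine-bound : ∀ {m l} (f : Fin m → Point π) → Injective _≡_ _≡_ f → (∀ t → f t on l) →
                   m ≤ suc n
    onLine-bound f f-inj f∈l = injective⇒≤ (f-inj ∘ index-injective (f∈l _) (f∈l _))

    module _ {m : ℕ} {f : Fin m → Point π} (f-inj : Injective _≡_ _≡_ f) {P : Fin m → Set} {l : Line π}
             (P⊆l : ∀ {t} → P t → f t on l) where

      onLine-fits : Fits P (suc n)
      onLine-fits = record
        { code           = index ∘ P⊆l
        ; code-injective = λ p p' → f-inj ∘ index-injective (P⊆l p) (P⊆l p')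
        }

      onLine-avoiding-fits : ∀ {x} → x on l → (∀ {t} → P t → f t ≢ x) → Fits P n
      onLine-avoiding-fits x∈l avoids = record
        { code           = λ p → punchOut (x≢ p)
        ; code-injective = λ p p' → f-inj ∘ index-injective (P⊆l p) (P⊆l p')
                                           ∘ punchOut-injective (x≢ p) (x≢ p')
        }
        where
        x≢ : ∀ {t} (p : P t) → index x∈l ≢ index (P⊆l p)
        x≢ p e = avoids p (sym (index-injective x∈l (P⊆l p) e))

    -- Lines through a point off ℓ are told apart by where they meet ℓ.
    pencil-bound : ∀ {a ℓ m} → ¬ a on ℓ → (L : Fin m → Line π) → Injective _≡_ _≡_ L →
                   (∀ t → a on L t) → m ≤ suc n
    pencil-bound {a} {ℓ} a∉ℓ L L-inj a∈L = onLine-bound x x-injective (meetPoint-onʳ ∘ L≢ℓ)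
      where
      L≢ℓ : ∀ t → L t ≢ ℓ
      L≢ℓ t L≡ℓ = a∉ℓ (subst (a on_) L≡ℓ (a∈L t))

      x : ∀ t → Point π
      x t = meetPoint (L≢ℓ t)

      x-injective : Injective _≡_ _≡_ x
      x-injective {t} {t'} e = L-inj (line-unique a≢x (a∈L t) (meetPoint-onˡ (L≢ℓ t))
                                        (a∈L t') (subst (_on L t') (sym e) (meetPoint-onˡ (L≢ℓ t'))))
        where
        a≢x : a ≢ x t
        a≢x a≡x = a∉ℓ (subst (_on ℓ) (sym a≡x) (meetPoint-onʳ (L≢ℓ t)))

    -- The line through two of the four points in general position carries a third point:
    -- its meet with the line through the other two.
    order≥2 : 2 ≤ n
    order≥2 = ℕ.≤-pred (onLine-bound (lookupᵥ (q₀ ∷ q₁ ∷ x ∷ [])) (lookup₃-injective q₀≢q₁ q₀≢x q₁≢x) on-l)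
      where
      q₀ q₁ q₂ q₃ : Point π
      q₀ = quad π zero
      q₁ = quad π (suc zero)
      q₂ = quad π (suc (suc zero))
      q₃ = quad π (suc (suc (suc zero)))

      q₀≢q₁ : q₀ ≢ q₁
      q₀≢q₁ = (λ ()) ∘ quad-inj π

      q₂≢q₃ : q₂ ≢ q₃
      q₂≢q₃ = (λ ()) ∘ quad-inj π

      l l' : Line π
      l  = lineThrough π q₀ q₁ q₀≢q₁
      l' = lineThrough π q₂ q₃ q₂≢q₃

      l≢l' : l ≢ l'
      l≢l' l≡l' = quad-gen π l zero (suc zero) (suc (suc zero)) (λ ()) (λ ()) (λ ())
        (lineThrough-onˡ q₀≢q₁ , lineThrough-onʳ q₀≢q₁ , subst (q₂ on_) (sym l≡l') (lineThrough-onˡ q₂≢q₃))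

      x : Point π
      x = meetPoint l≢l'

      q₀≢x : q₀ ≢ x
      q₀≢x q₀≡x = quad-gen π l' zero (suc (suc zero)) (suc (suc (suc zero))) (λ ()) (λ ()) (λ ())
        (subst (_on l') (sym q₀≡x) (meetPoint-onʳ l≢l') , lineThrough-onˡ q₂≢q₃ , lineThrough-onʳ q₂≢q₃)

      q₁≢x : q₁ ≢ x
      q₁≢x q₁≡x = quad-gen π l' (suc zero) (suc (suc zero)) (suc (suc (suc zero))) (λ ()) (λ ()) (λ ())
        (subst (_on l') (sym q₁≡x) (meetPoint-onʳ l≢l') , lineThrough-onˡ q₂≢q₃ , lineThrough-onʳ q₂≢q₃)

      on-l : ∀ t → lookupᵥ (q₀ ∷ q₁ ∷ x ∷ []) t on l
      on-l zero             = lineThrough-onˡ q₀≢q₁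
      on-l (suc zero)       = lineThrough-onʳ q₀≢q₁
      on-l (suc (suc zero)) = meetPoint-onˡ l≢l'

module _ {π₀ π : ProjectivePlane} (s : Subplane π₀ π) where
  open Plane π
  private module P₀ = Plane π₀
  open P₀ using () renaming (_on_ to _on₀_)

  incidence-reflected : ∀ {p r L} → p ≢ r → p on₀ L → ιP s r on ιL s L → r on₀ L
  incidence-reflected {p} {r} {L} p≢r p∈L r∈ιL = subst (r on₀_) (ιL-inj s ιM≡ιL) (P₀.lineThrough-onʳ p≢r)
    where
    ιM≡ιL : ιL s (lineThrough π₀ p r p≢r) ≡ ιL s L
    ιM≡ιL = line-unique (p≢r ∘ ιP-inj s) (ιI s _ _ (P₀.lineThrough-onˡ p≢r)) (ιI s _ _ (P₀.lineThrough-onʳ p≢r))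
                        (ιI s _ _ p∈L) r∈ιL

module EdgeLines {q : ℕ} {π : ProjectivePlane} (ψ : Embedding q π) where
  open Plane π

  left right : Fin q → Point π
  left i  = φ ψ (inj₁ i)
  right j = φ ψ (inj₂ j)

  edge : Fin q → Fin q → Line π
  edge i j = edgeLine π (φ ψ) (φ-inj ψ) (i , j)

  edge-onˡ : ∀ {i j} → left i on edge i j
  edge-onˡ {i} {j} = lineThrough-onˡ (endpoints-distinct π (φ ψ) (φ-inj ψ) (i , j))

  edge-onʳ : ∀ {i j} → right j on edge i j
  edge-onʳ {i} {j} = lineThrough-onʳ (endpoints-distinct π (φ ψ) (φ-inj ψ) (i , j))

  edge-unique : ∀ {i j l} → left i on l → right j on l → l ≡ edge i j
  edge-unique {i} {j} = lineThrough-unique (endpoints-distinct π (φ ψ) (φ-inj ψ) (i , j))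

  no-line-through-left-right-right : ∀ {i j j' l} → j ≢ j' →
                                     left i on l → right j on l → right j' on l → ⊥
  no-line-through-left-right-right j≢j' i∈l j∈l j'∈l =
    j≢j' (cong proj₂ (edgeLine-inj ψ (trans (sym (edge-unique i∈l j∈l)) (edge-unique i∈l j'∈l))))

swapEmbedding : ∀ {q π} → Embedding q π → Embedding q π
swapEmbedding {π = π} ψ = record
  { φ            = φ ψ ∘ swap
  ; φ-inj        = φ∘swap-injective
  ; edgeLine-inj = swapped-edgeLine-injective
  }
  where
  open Plane π
  open EdgeLines ψ

  φ∘swap-injective : Injective _≡_ _≡_ (φ ψ ∘ swap)
  φ∘swap-injective {v} {v'} e =
    trans (sym (swap-involutive v)) (trans (cong swap (φ-inj ψ e)) (swap-involutive v'))

  swapped-edgeLine : ∀ i j → edgeLine π (φ ψ ∘ swap) φ∘swap-injective (i , j) ≡ edge j i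
  swapped-edgeLine i j = edge-unique (lineThrough-onʳ d) (lineThrough-onˡ d)
    where d = endpoints-distinct π (φ ψ ∘ swap) φ∘swap-injective (i , j)

  swapped-edgeLine-injective : Injective _≡_ _≡_ (edgeLine π (φ ψ ∘ swap) φ∘swap-injective)
  swapped-edgeLine-injective {i , j} {i' , j'} e
    with edgeLine-inj ψ (trans (sym (swapped-edgeLine i j)) (trans e (swapped-edgeLine i' j')))
  ... | refl = refl

module Collinearity {q : ℕ} {π : ProjectivePlane} (order : HasOrder π q) (ψ : Embedding q π) where
  open Plane π
  open Order order
  open EdgeLines ψ

  no-line-through-left-left-right : ∀ {i i' j l} → i ≢ i' →
                                    left i on l → left i' on l → right j on l → ⊥
  no-line-through-left-left-right i≢i' i∈l i'∈l j∈l =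
    EdgeLines.no-line-through-left-right-right (swapEmbedding ψ) i≢i' j∈l i∈l i'∈l

  lefts-collinear : ∀ {i j l} → i ≢ j → left i on l → left j on l → ∀ k → left k on l
  lefts-collinear {i} {j} {l} i≢j i∈l j∈l k with on? (left k) l
  ... | yes k∈l = k∈l
  ... | no  k∉l = contradiction (pencil-bound a∉ℓ lines lines-injective a∈lines) ℕ.1+n≰n
    where
    a : Point π
    a = left i

    rᵢ≢rⱼ : right i ≢ right j
    rᵢ≢rⱼ = i≢j ∘ inj₂-injective ∘ φ-inj ψ

    a∉ℓ : ¬ a on lineThrough π (right i) (right j) rᵢ≢rⱼ
    a∉ℓ a∈ℓ = no-line-through-left-right-right i≢j a∈ℓ (lineThrough-onˡ rᵢ≢rⱼ) (lineThrough-onʳ rᵢ≢rⱼ)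

    a≢left-k : a ≢ left k
    a≢left-k a≡k = k∉l (subst (_on l) a≡k i∈l)

    m : Line π
    m = lineThrough π a (left k) a≢left-k

    lines : Fin (2 + q) → Line π
    lines zero          = l
    lines (suc zero)    = m
    lines (suc (suc t)) = edge i t

    a∈lines : ∀ t → a on lines t
    a∈lines zero          = i∈l
    a∈lines (suc zero)    = lineThrough-onˡ a≢left-k
    a∈lines (suc (suc t)) = edge-onˡ

    l≢m : l ≢ m
    l≢m l≡m = k∉l (subst (left k on_) (sym l≡m) (lineThrough-onʳ a≢left-k))

    l≢edge : ∀ {t} → l ≢ edge i t
    l≢edge l≡e = no-line-through-left-left-right i≢j edge-onˡ (subst (left j on_) l≡e j∈l) edge-onʳ

    m≢edge : ∀ {t} → m ≢ edge i t
    m≢edge m≡e = no-line-through-left-left-right (a≢left-k ∘ cong left) edge-onˡ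
                   (subst (left k on_) m≡e (lineThrough-onʳ a≢left-k)) edge-onʳ

    lines-injective : Injective _≡_ _≡_ lines
    lines-injective {zero}        {zero}         _ = refl
    lines-injective {zero}        {suc zero}     e = contradiction e l≢m
    lines-injective {zero}        {suc (suc _)}  e = contradiction e l≢edge
    lines-injective {suc zero}    {zero}         e = contradiction (sym e) l≢m
    lines-injective {suc zero}    {suc zero}     _ = refl
    lines-injective {suc zero}    {suc (suc _)}  e = contradiction e m≢edge
    lines-injective {suc (suc _)} {zero}         e = contradiction (sym e) l≢edge
    lines-injective {suc (suc _)} {suc zero}     e = contradiction (sym e) m≢edge
    lines-injective {suc (suc _)} {suc (suc _)}  e = cong suc (cong suc (cong proj₂ (edgeLine-inj ψ e)))

data Shape (π₀ : ProjectivePlane) {m : ℕ} (f : Fin m → Point π₀) (P : Fin m → Set) : Set where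
  atMostOne : (∀ {t t'} → P t → P t' → t ≡ t') → Shape π₀ f P
  -- The witness is what keeps the lines of two opposite sides distinct.
  onLine    : (L : Line π₀) → (∀ {t} → P t → _I_ π₀ (f t) L) → (∀ {t} → _I_ π₀ (f t) L → P t) →
              ∃ P → Shape π₀ f P

module TwoShapes {n : ℕ} {π₀ : ProjectivePlane} (order : HasOrder π₀ n)
                 {m : ℕ} {f : Fin m → Point π₀} (f-inj : Injective _≡_ _≡_ f) where
  open Plane π₀
  open Order order

  private
    n+n≤2*n : n + n ≤ 2 * n
    n+n≤2*n = ℕ.≤-reflexive (cong (n +_) (sym (ℕ.+-identityʳ n)))

    2+n≤2*n : 2 + n ≤ 2 * n
    2+n≤2*n = ℕ.≤-trans (ℕ.+-monoˡ-≤ n order≥2) n+n≤2*n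

  shapes-bound : ∀ {P Q : Fin m → Set} → (∀ t → P t ⊎ Q t) → (∀ {t} → P t → Q t → ⊥) →
                 Shape π₀ f P → Shape π₀ f Q → m ≤ 2 * n
  shapes-bound {P} {Q} cover disjoint (onLine L P⊆L L⊆P (t₀ , p₀)) (onLine L' Q⊆L' L'⊆Q _) =
    ℕ.≤-trans (partition-bound cover (onLine-avoiding-fits f-inj P⊆L (meetPoint-onˡ L≢L') P-avoids-x)
                                     (onLine-avoiding-fits f-inj Q⊆L' (meetPoint-onʳ L≢L') Q-avoids-x))
              n+n≤2*n
    where
    L≢L' : L ≢ L'
    L≢L' L≡L' = disjoint p₀ (L'⊆Q (subst (f t₀ on_) L≡L' (P⊆L p₀)))

    x : Point π₀
    x = meetPoint L≢L'

    P-avoids-x : ∀ {t} → P t → f t ≢ x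
    P-avoids-x p fₜ≡x = disjoint p (L'⊆Q (subst (_on L') (sym fₜ≡x) (meetPoint-onʳ L≢L')))

    Q-avoids-x : ∀ {t} → Q t → f t ≢ x
    Q-avoids-x q fₜ≡x = disjoint (L⊆P (subst (_on L) (sym fₜ≡x) (meetPoint-onˡ L≢L'))) q
  shapes-bound cover _ (onLine _ P⊆L _ _) (atMostOne Q-unique) =
    ℕ.≤-trans (partition-bound cover (onLine-fits f-inj P⊆L) (atMostOne-fits Q-unique))
              (ℕ.≤-trans (ℕ.≤-reflexive (ℕ.+-comm (suc n) 1)) 2+n≤2*n)
  shapes-bound cover _ (atMostOne P-unique) (onLine _ Q⊆L _ _) =
    ℕ.≤-trans (partition-bound cover (atMostOne-fits P-unique) (onLine-fits f-inj Q⊆L)) 2+n≤2*n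
  shapes-bound cover _ (atMostOne P-unique) (atMostOne Q-unique) =
    ℕ.≤-trans (partition-bound cover (atMostOne-fits P-unique) (atMostOne-fits Q-unique))
              (ℕ.≤-trans order≥2 (ℕ.m≤m+n n _))

IsLeft : ∀ {q} → Vertex q → Set
IsLeft v = ∃ λ i → v ≡ inj₁ i

isLeft? : ∀ {q} (v : Vertex q) → Dec (IsLeft v)
isLeft? (inj₁ i) = yes (i , refl)
isLeft? (inj₂ _) = no λ { (_ , ()) }

isLeft⊎isLeft∘swap : ∀ {q} (v : Vertex q) → IsLeft v ⊎ IsLeft (swap v)
isLeft⊎isLeft∘swap (inj₁ i) = inj₁ (i , refl)
isLeft⊎isLeft∘swap (inj₂ j) = inj₂ (j , refl)

¬isLeft×isLeft∘swap : ∀ {q} {v : Vertex q} → IsLeft v → IsLeft (swap v) → ⊥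
¬isLeft×isLeft∘swap (_ , refl) (_ , ())

module LeftShape {q : ℕ} {π : ProjectivePlane} (order : HasOrder π q) (χ : Embedding q π)
                 {π₀ : ProjectivePlane} (s : Subplane π₀ π)
                 {m : ℕ} {f : Fin m → Point π₀} (f-inj : Injective _≡_ _≡_ f)
                 (w : Fin m → Vertex q) (φw≡ιf : ∀ t → φ χ (w t) ≡ ιP s (f t)) where
  open Plane π
  open EdgeLines χ
  open Collinearity order χ
  private module P₀ = Plane π₀
  open P₀ using () renaming (_on_ to _on₀_)

  Left : Fin m → Set
  Left t = IsLeft (w t)

  image : ∀ {t v} → w t ≡ v → φ χ v ≡ ιP s (f t)
  image {t} wₜ≡v = trans (cong (φ χ) (sym wₜ≡v)) (φw≡ιf t)

  module LineThroughTwoLefts {t₁ t₂ i₁ i₂} (t₁≢t₂ : t₁ ≢ t₂) (w₁ : w t₁ ≡ inj₁ i₁) (w₂ : w t₂ ≡ inj₁ i₂) where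
    f₁≢f₂ : f t₁ ≢ f t₂
    f₁≢f₂ = t₁≢t₂ ∘ f-inj

    L : Line π₀
    L = lineThrough π₀ (f t₁) (f t₂) f₁≢f₂

    i₁≢i₂ : i₁ ≢ i₂
    i₁≢i₂ i₁≡i₂ = t₁≢t₂ (f-inj (ιP-inj s (trans (sym (image w₁)) (trans (cong left i₁≡i₂) (image w₂)))))

    left₁ : left i₁ on ιL s L
    left₁ = subst (_on ιL s L) (sym (image w₁)) (ιI s _ _ (P₀.lineThrough-onˡ f₁≢f₂))

    left₂ : left i₂ on ιL s L
    left₂ = subst (_on ιL s L) (sym (image w₂)) (ιI s _ _ (P₀.lineThrough-onʳ f₁≢f₂))

    lefts-on-L : ∀ {t} → Left t → f t on₀ L
    lefts-on-L {t} (k , wₜ) with t ≟ t₁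
    ... | yes refl = P₀.lineThrough-onˡ f₁≢f₂
    ... | no t≢t₁  = incidence-reflected s (t≢t₁ ∘ sym ∘ f-inj) (P₀.lineThrough-onˡ f₁≢f₂)
                       (subst (_on ιL s L) (image wₜ) (lefts-collinear i₁≢i₂ left₁ left₂ k))

    on-L-left : ∀ {t} → f t on₀ L → Left t
    on-L-left {t} fₜ∈L with w t in wₜ
    ... | inj₁ i = i , refl
    ... | inj₂ j = ⊥-elim (no-line-through-left-left-right i₁≢i₂ left₁ left₂
                             (subst (_on ιL s L) (sym (image wₜ)) (ιI s _ _ fₜ∈L)))

  left-shape : Shape π₀ f Left
  left-shape with any? (λ t₁ → any? λ t₂ → ¬? (t₁ ≟ t₂) ×-dec isLeft? (w t₁) ×-dec isLeft? (w t₂))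
  ... | yes (t₁ , t₂ , t₁≢t₂ , (i₁ , w₁) , (i₂ , w₂)) = onLine L lefts-on-L on-L-left (t₁ , i₁ , w₁)
    where open LineThroughTwoLefts t₁≢t₂ w₁ w₂
  ... | no ∄ = atMostOne λ {t} {t'} lₜ lₜ' →
                 decidable-stable (t ≟ t') λ t≢t' → ∄ (t , t' , t≢t' , lₜ , lₜ')

embedded-points-bound : ∀ {q π} → HasOrder π q → (ψ : Embedding q π) →
                        ∀ {n π₀} → HasOrder π₀ n → (s : Subplane π₀ π) →
                        ∀ {m} (f : Fin m → Point π₀) → Injective _≡_ _≡_ f →
                        (w : Fin m → Vertex q) → (∀ t → φ ψ (w t) ≡ ιP s (f t)) → m ≤ 2 * n
embedded-points-bound order ψ order₀ s f f-inj w φw≡ιf =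
  shapes-bound (isLeft⊎isLeft∘swap ∘ w) ¬isLeft×isLeft∘swap
    (LeftShape.left-shape order ψ s f-inj w φw≡ιf)
    (LeftShape.left-shape order (swapEmbedding ψ) s f-inj (swap ∘ w) φ∘swap∘swap∘w≡ιf)
  where
  open TwoShapes order₀ f-inj

  φ∘swap∘swap∘w≡ιf : ∀ t → φ ψ (swap (swap (w t))) ≡ ιP s (f t)
  φ∘swap∘swap∘w≡ιf t = trans (cong (φ ψ) (swap-involutive (w t))) (φw≡ιf t)

corollary4p12 : (q : ℕ) (π : ProjectivePlane) → HasOrder π q →
                (ψ : Embedding q π) →
                (n : ℕ) (π₀ : ProjectivePlane) → HasOrder π₀ n → (s : Subplane π₀ π) →
                (ps : List (Point π₀)) → Unique ps →
                All (λ p → ∃ λ v → φ ψ v ≡ ιP s p) ps →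
                length ps ≤ 2 * n
corollary4p12 q π order ψ n π₀ order₀ s ps unique embedded =
  embedded-points-bound order ψ order₀ s (lookup ps) (lookup-injective unique)
    (proj₁ ∘ witness) (proj₂ ∘ witness)
  where
  witness : ∀ t → ∃ λ v → φ ψ v ≡ ιP s (lookup ps t)
  witness t = All.lookup embedded (∈-lookup t)
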